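{- Let $\alpha\in\mathcal{CO}$ and $\psi\in\mathcal{PCO}$. Then: (1) $\alpha\supset\psi \models \Pr(\alpha)=1\rightarrow \psi$; (2) if $\alpha$ has no occurrences of $\lor$, then $\alpha\supset\psi \models \alpha \rightarrow \psi$.
   Context: Causal multiteams $T=(T^-,\mathcal{F})$ are finite multisets of assignments paired with a function component of structural equations compatible with every row. $\mathcal{CO}$: $\alpha ::= Y=y \mid Y\neq y \mid \alpha\land\alpha \mid \alpha\lor\alpha \mid \alpha\supset\alpha \mid \mathbf X=\mathbf x \mathrel{\Box\!\!\rightarrow} \alpha$ ($\mathrel{\Box\!\!\rightarrow}$ the interventionist counterfactual, evaluated on the intervened multiteam). $\mathcal{PCO}$: $\varphi ::= \eta \mid \varphi\land\varphi \mid \varphi\sqcup\varphi \mid \alpha\supset\varphi \mid \mathbf X=\mathbf x\mathrel{\Box\!\!\rightarrow}\varphi$, with atoms $\eta$ literals or probabilistic atoms $\Pr(\alpha)\geq\epsilon$, $\Pr(\alpha)>\epsilon$, $\Pr(\alpha)\geq\Pr(\beta)$, $\Pr(\alpha)>\Pr(\beta)$, true in $T$ iff $T$ is empty or the inequality holds for $P_T(\alpha)=|(T^\alpha)^-|/|T^-|$. Here $T^\alpha$ is the sub-multiteam of rows $s$ with $(\{s\},\mathcal{F})\models\alpha$ and $T\models\alpha\supset\psi$ iff $T^\alpha\models\psi$; $\sqcup$ is Boolean disjunction. $\Pr(\alpha)=1$ abbreviates $\Pr(\alpha)\geq1\land\Pr(\neg\alpha)\geq 0$ (true iff $T$ empty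 or $P_T(\alpha)=1$). $\psi\rightarrow\chi$ abbreviates $\psi^C\sqcup\chi$, where $^C$ is the inductively defined weak contradictory negation satisfying $T\models\psi^C$ iff $T\not\models\psi$ for nonempty $T$; thus $T\models\psi\rightarrow\chi$ iff $T\not\models\psi$ or $T\models\chi$. $\Gamma\models\varphi$ means every causal multiteam satisfying $\Gamma$ satisfies $\varphi$. -}

module Defs where

open import Data.Nat using (ℕ; zero; suc; _<_; s≤s)
open import Data.Nat.Properties using (<-≤-trans; ≤-refl)
open import Data.Fin using (Fin; _≟_)
open import Data.Bool using (Bool; true; false; not; _∧_; _∨_)
open import Data.Maybe using (Maybe; just; nothing)
open import Data.List using (List; []; _∷_; map; length; filterᵇ)
open import Data.List.Relation.Unary.All using (All)
open import Data.Integer using (+_)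
open import Data.Rational using (ℚ; 0ℚ; 1ℚ; _/_) renaming (_≤_ to _≤ℚ_; _<_ to _<ℚ_)
open import Data.Rational.Properties using (_≤?_)
open import Data.Product using (_×_; _,_)
open import Data.Sum using (_⊎_)
open import Data.Unit using (⊤)
open import Data.Empty using (⊥)
open import Relation.Nullary using (¬_; ⌊_⌋)
open import Relation.Nullary.Decidable using (toWitness)
open import Relation.Binary.PropositionalEquality using (_≡_; _≢_)

-- Signatures: finitely many variables Fin n, each with a finite
-- nonempty range Ran(V) = Fin (suc (rng V)).

record Signature : Set where
  field
    n   : ℕ
    rng : Fin n → ℕ

module _ (σ : Signature) where
  open Signature σ

  Var : Set
  Var = Fin n

  Val : Var → Set
  Val v = Fin (suc (rng v))

  Asg : Set
  Asg = (v : Var) → Val v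

  -- an intervention  X = x : the variables X are those mapped to 'just x_V'
  Intv : Set
  Intv = (v : Var) → Maybe (Val v)

-- Acyclicity is witnessed by
-- a rank function: the structural equation F_V of an endogenous
-- variable V may only read variables of strictly smaller rank.
-- 'eqn V = nothing' means V is exogenous.

record FunComp (σ : Signature) : Set where
  field
    rk  : Var σ → ℕ
    eqn : (V : Var σ) →
          Maybe ((((u : Var σ) → rk u < rk V → Val σ u)) → Val σ V)
open FunComp public

module _ {σ : Signature} where

  doF : FunComp σ → Intv σ → FunComp σ
  rk  (doF F X) = rk F
  eqn (doF F X) V with X V
  ... | just _  = nothing
  ... | nothing = eqn F V

  -- s^F_{X=x}: the unique solution of the intervened system whose
  -- exogenous (non-intervened) values are those of s; computed by
  -- recursion along the rank.
  doRow : FunComp σ → Intv σ → Asg σ → Asg σ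
  doRow F X s V = go (suc (rk F V)) V ≤-refl
    where
    go : (k : ℕ) → (V : Var σ) → rk F V < k → Val σ V
    go (suc k) V (s≤s p) with X V
    ... | just x  = x
    ... | nothing with eqn F V
    ...   | just f  = f (λ u q → go k u (<-≤-trans q p))
    ...   | nothing = s V

  Compatible : FunComp σ → Asg σ → Set
  Compatible F s = ∀ V f → eqn F V ≡ just f → s V ≡ f (λ u _ → s u)

-- Causal multiteams: a finite multiset of assignments (a list; order is
-- irrelevant for all notions below) with a compatible function component.

record CausalMultiteam (σ : Signature) : Set where
  field
    rows   : List (Asg σ)
    F      : FunComp σ
    compat : All (Compatible F) rows
open CausalMultiteam public

data CO (σ : Signature) : Set where
  _≐_    : (Y : Var σ) → Val σ Y → CO σ
  _≠_    : (Y : Var σ) → Val σ Y → CO σ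
  _∧ᶜ_   : CO σ → CO σ → CO σ
  _∨ᶜ_   : CO σ → CO σ → CO σ
  _⊃ᶜ_   : CO σ → CO σ → CO σ
  _□→ᶜ_  : Intv σ → CO σ → CO σ

negᶜ : {σ : Signature} → CO σ → CO σ
negᶜ (Y ≐ y)    = Y ≠ y
negᶜ (Y ≠ y)    = Y ≐ y
negᶜ (α ∧ᶜ β)   = negᶜ α ∨ᶜ negᶜ β
negᶜ (α ∨ᶜ β)   = negᶜ α ∧ᶜ negᶜ β
negᶜ (α ⊃ᶜ β)   = α ∧ᶜ negᶜ β
negᶜ (X □→ᶜ α)  = X □→ᶜ negᶜ α

-- Satisfaction of CO formulas on a singleton causal multiteam ({s},F)
-- (this is all that T^α and P_T(α) use).
satR : {σ : Signature} → FunComp σ → Asg σ → CO σ → Bool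
satR F s (Y ≐ y)   = ⌊ s Y ≟ y ⌋
satR F s (Y ≠ y)   = not ⌊ s Y ≟ y ⌋
satR F s (α ∧ᶜ β)  = satR F s α ∧ satR F s β
satR F s (α ∨ᶜ β)  = satR F s α ∨ satR F s β
satR F s (α ⊃ᶜ β)  = not (satR F s α) ∨ satR F s β
satR F s (X □→ᶜ α) = satR (doF F X) (doRow F X s) α

NoOr : {σ : Signature} → CO σ → Set
NoOr (Y ≐ y)   = ⊤
NoOr (Y ≠ y)   = ⊤
NoOr (α ∧ᶜ β)  = NoOr α × NoOr β
NoOr (α ∨ᶜ β)  = ⊥
NoOr (α ⊃ᶜ β)  = NoOr α × NoOr β
NoOr (X □→ᶜ α) = NoOr α

data PCO (σ : Signature) : Set where
  eqL    : (Y : Var σ) → Val σ Y → PCO σ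
  neqL   : (Y : Var σ) → Val σ Y → PCO σ
  PrGe   : CO σ → (ε : ℚ) → 0ℚ ≤ℚ ε → ε ≤ℚ 1ℚ → PCO σ
  PrGt   : CO σ → (ε : ℚ) → 0ℚ ≤ℚ ε → ε ≤ℚ 1ℚ → PCO σ
  PrGePr : CO σ → CO σ → PCO σ
  PrGtPr : CO σ → CO σ → PCO σ
  _∧ᵖ_   : PCO σ → PCO σ → PCO σ
  _⊔_    : PCO σ → PCO σ → PCO σ
  _⊃ᵖ_   : CO σ → PCO σ → PCO σ
  _□→ᵖ_  : Intv σ → PCO σ → PCO σ

toPCO : {σ : Signature} → (α : CO σ) → NoOr α → PCO σ
toPCO (Y ≐ y)   _        = eqL Y y
toPCO (Y ≠ y)   _        = neqL Y y
toPCO (α ∧ᶜ β)  (p , q)  = toPCO α p ∧ᵖ toPCO β q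
toPCO (α ∨ᶜ β)  ()
toPCO (α ⊃ᶜ β)  (p , q)  = α ⊃ᵖ toPCO β q
toPCO (X □→ᶜ α) p        = X □→ᵖ toPCO α p

0≤1 : 0ℚ ≤ℚ 1ℚ
0≤1 = toWitness {a? = 0ℚ ≤? 1ℚ} _

0≤0 : 0ℚ ≤ℚ 0ℚ
0≤0 = toWitness {a? = 0ℚ ≤? 0ℚ} _

1≤1 : 1ℚ ≤ℚ 1ℚ
1≤1 = toWitness {a? = 1ℚ ≤? 1ℚ} _

Pr1 : {σ : Signature} → CO σ → PCO σ
Pr1 α = PrGe α 1ℚ 0≤1 1≤1 ∧ᵖ PrGe (negᶜ α) 0ℚ 0≤0 0≤1

restrict : {σ : Signature} → FunComp σ → CO σ → List (Asg σ) → List (Asg σ)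
restrict F α = filterᵇ (λ s → satR F s α)

cnt : {σ : Signature} → FunComp σ → CO σ → List (Asg σ) → ℕ
cnt F α ts = length (restrict F α ts)

-- "T is empty, or R holds of P_T(α) = c / |T^-|"
ProbAtom : ℕ → ℕ → (ℚ → Set) → Set
ProbAtom c zero    R = ⊤
ProbAtom c (suc k) R = R ((+ c) / suc k)

ProbAtom₂ : ℕ → ℕ → ℕ → (ℚ → ℚ → Set) → Set
ProbAtom₂ c d zero    R = ⊤
ProbAtom₂ c d (suc k) R = R ((+ c) / suc k) ((+ d) / suc k)

sat : {σ : Signature} → List (Asg σ) → FunComp σ → PCO σ → Set
sat ts F (eqL Y y)        = All (λ s → s Y ≡ y) ts
sat ts F (neqL Y y)       = All (λ s → s Y ≢ y) ts
sat ts F (PrGe α ε _ _)   = ProbAtom (cnt F α ts) (length ts) (λ p → ε ≤ℚ p)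
sat ts F (PrGt α ε _ _)   = ProbAtom (cnt F α ts) (length ts) (λ p → ε <ℚ p)
sat ts F (PrGePr α β)     = ProbAtom₂ (cnt F α ts) (cnt F β ts) (length ts) (λ p q → q ≤ℚ p)
sat ts F (PrGtPr α β)     = ProbAtom₂ (cnt F α ts) (cnt F β ts) (length ts) (λ p q → q <ℚ p)
sat ts F (φ ∧ᵖ χ)         = sat ts F φ × sat ts F χ
sat ts F (φ ⊔ χ)          = sat ts F φ ⊎ sat ts F χ
sat ts F (α ⊃ᵖ φ)         = sat (restrict F α ts) F φ
sat ts F (X □→ᵖ φ)        = sat (map (doRow F X) ts) (doF F X) φ

_⊨_ : {σ : Signature} → CausalMultiteam σ → PCO σ → Set
T ⊨ φ = sat (rows T) (F T) φ

-- T ⊨ φ → χ   (φ → χ := φ^C ⊔ χ ; true iff T ⊭ φ or T ⊨ χ)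
_⊨_⇒_ : {σ : Signature} → CausalMultiteam σ → PCO σ → PCO σ → Set
T ⊨ φ ⇒ χ = ¬ (T ⊨ φ) ⊎ T ⊨ χ

{-# OPTIONS --safe #-}
-- Both antecedents, Pr(α) = 1 and a ∨-free α, force every row of T to satisfy
-- α: the first by counting (the rows satisfying α are as many as all rows),
-- the second by induction on α, every connective other than ∨ being evaluated
-- row by row.  If every row satisfies α then T^α = T, so T ⊨ α ⊃ ψ gives T ⊨ ψ;
-- otherwise the antecedent fails.
module Submission where

open import Defs
open import Data.Bool using (Bool; true; false; not; _∨_; T)
open import Data.Bool.Properties using (T?; T-∧)
open import Data.Empty using (⊥-elim)
open import Data.Integer as ℤ using (+_)
open import Data.Integer.GCD using (gcd)
import Data.Integer.Properties as ℤ
open import Data.List using (List; []; _∷_; filter; map; length)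
open import Data.List.Properties using (length-filter; filter-all; filter-complete)
open import Data.List.Relation.Unary.All as All using (All; []; all?)
open import Data.List.Relation.Unary.All.Properties using (all-filter; filter⁻; map⁻)
import Data.Nat as ℕ
open import Data.Nat.Properties using (≤-antisym)
open import Data.Product using (_×_; _,_)
open import Data.Rational using (ℚ; 1ℚ; _/_; ↥_; ↧_; *≤*) renaming (_≤_ to _≤ℚ_)
open import Data.Rational.Properties using (↥-/; ↧-/)
open import Data.Sum using (inj₁; inj₂)
open import Level using (0ℓ)
open import Function using (_∘_; const)
open import Function.Bundles using (Equivalence)
open import Relation.Nullary using (yes; no)
open import Relation.Nullary.Decidable using (fromWitness; fromWitnessFalse; ¬?)
open import Relation.Unary using (Pred; Decidable)
open import Relation.Binary.PropositionalEquality using (_≡_; subst; subst₂; sym)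

1≤c/d⇒d≤c : ∀ c d .{{_ : ℕ.NonZero d}} → 1ℚ ≤ℚ (+ c) / d → d ℕ.≤ c
1≤c/d⇒d≤c c d (*≤* 1≤q) = ℤ.drop‿+≤+ (begin
  + d       ≡⟨ sym (↧-/ (+ c) d) ⟩
  ↧ q ℤ.* g ≤⟨ ℤ.*-monoʳ-≤-nonNeg g ↧q≤↥q ⟩
  ↥ q ℤ.* g ≡⟨ ↥-/ (+ c) d ⟩
  + c       ∎)
  where
  open ℤ.≤-Reasoning
  q : ℚ
  q = (+ c) / d
  g : ℤ.ℤ
  g = gcd (+ c) (+ d)
  ↧q≤↥q : ↧ q ℤ.≤ ↥ q
  ↧q≤↥q = subst₂ ℤ._≤_ (ℤ.*-identityˡ (↧ q)) (ℤ.*-identityʳ (↥ q)) 1≤q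

T-⊃ : ∀ {a b : Bool} → (T a → T b) → T (not a ∨ b)
T-⊃ {true}  a⇒b = a⇒b _
T-⊃ {false} _   = _

all-filter⇒all-⇒ : ∀ {a p q} {A : Set a} {P : Pred A p} {Q : Pred A q}
  (P? : Decidable P) (xs : List A) →
  All Q (filter P? xs) → All (λ x → P x → Q x) xs
all-filter⇒all-⇒ P? xs qs =
  filter⁻ P? (All.map const qs)
             (All.map (λ ¬px px → ⊥-elim (¬px px)) (all-filter (¬? ∘ P?) xs))

Holds : ∀ {σ} → FunComp σ → CO σ → Pred (Asg σ) 0ℓ
Holds F α s = T (satR F s α)

holds? : ∀ {σ} (F : FunComp σ) (α : CO σ) → Decidable (Holds F α)
holds? F α = T? ∘ λ s → satR F s α

Pr1⇒all-holds : ∀ {σ} (F : FunComp σ) α ts → sat ts F (Pr1 α) → All (Holds F α) ts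
Pr1⇒all-holds F α []         _         = []
Pr1⇒all-holds F α ts@(_ ∷ _) (1≤P , _) =
  subst (All (Holds F α)) (filter-complete (holds? F α) |filter|≡|ts|) (all-filter (holds? F α) ts)
  where
  |filter|≡|ts| : length (restrict F α ts) ≡ length ts
  |filter|≡|ts| = ≤-antisym (length-filter (holds? F α) ts) (1≤c/d⇒d≤c _ _ 1≤P)

toPCO⇒all-holds : ∀ {σ} (F : FunComp σ) α (noOr : NoOr α) ts →
  sat ts F (toPCO α noOr) → All (Holds F α) ts
toPCO⇒all-holds F (Y ≐ y)   _       ts eqs  = All.map fromWitness eqs
toPCO⇒all-holds F (Y ≠ y)   _       ts neqs = All.map fromWitnessFalse neqs
toPCO⇒all-holds F (α ∧ᶜ β)  (p , q) ts (sα , sβ) =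
  All.zipWith (Equivalence.from T-∧) (toPCO⇒all-holds F α p ts sα , toPCO⇒all-holds F β q ts sβ)
toPCO⇒all-holds F (α ⊃ᶜ β)  (_ , q) ts sβ =
  All.map T-⊃ (all-filter⇒all-⇒ (holds? F α) ts (toPCO⇒all-holds F β q (restrict F α ts) sβ))
toPCO⇒all-holds F (X □→ᶜ α) p       ts s =
  map⁻ (toPCO⇒all-holds (doF F X) α p (map (doRow F X) ts) s)

⊃-⇒-of-all-holds : ∀ {σ} (α : CO σ) (φ ψ : PCO σ) (T : CausalMultiteam σ) →
  (T ⊨ φ → All (Holds (F T) α) (rows T)) → T ⊨ (α ⊃ᵖ ψ) → T ⊨ φ ⇒ ψ
⊃-⇒-of-all-holds α φ ψ T φ⇒all ⊨α⊃ψ with all? (holds? (F T) α) (rows T)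
... | yes all-α = inj₂ (subst (λ ts → sat ts (F T) ψ) (filter-all (holds? (F T) α) all-α) ⊨α⊃ψ)
... | no ¬all-α = inj₁ (¬all-α ∘ φ⇒all)

mainTheorem5 : (σ : Signature) (α : CO σ) (ψ : PCO σ) →
    ((T : CausalMultiteam σ) → T ⊨ (α ⊃ᵖ ψ) → T ⊨ Pr1 α ⇒ ψ)
    × ((noOr : NoOr α) → (T : CausalMultiteam σ) → T ⊨ (α ⊃ᵖ ψ) → T ⊨ toPCO α noOr ⇒ ψ)
mainTheorem5 σ α ψ =
  (λ T → ⊃-⇒-of-all-holds α (Pr1 α) ψ T (Pr1⇒all-holds (F T) α (rows T))) ,
  (λ noOr T → ⊃-⇒-of-all-holds α (toPCO α noOr) ψ T (toPCO⇒all-holds (F T) α noOr (rows T)))
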